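{- Let $p$ be a prime, $q=p^{r}$, $F=\mathrm{GF}(q)$, $k\geq 3$ a divisor of $q-1$, $m=(q-1)/k$, $\zeta$ a generator of $F^{*}$, $\varphi=\zeta^{m}$ and $\Phi=\langle\varphi\rangle$ the subgroup of order $k$. Put \[ s=\sum_{j=1}^{k-1}\bigl|(\Phi+1)\cap(\Phi+\varphi^{j})\bigr|,\qquad t=|\Phi\cap(\Phi+1)|. \] Assume $(p,k)$ is circular. Then the number of solutions $(x,y,z)\in F^{3}$ of $x^{m}+y^{m}-z^{m}=1$ is \[ \begin{cases} m^{3}(k+s)+3m^{2}t+2m, & \text{if } k \text{ is odd and } p\neq 2;\\ m^{3}(k+s)+3m^{2}t+3m, & \text{if } k \text{ is even or } p=2.\end{cases} \]
   Context: For a finite field $E$ and its multiplicative subgroup $\Psi$ of order $k$, the pair $(E,\Psi)$ is circular if $|\Psi a\cap(\Psi b+c)|\leq 2$ for all $a,b,c\in E^{*}$. The pair $(p,k)$ is called circular if $(\mathrm{GF}(p^{r'}),\Psi)$ is circular for some $r'\in\mathbb{N}$ with $k\mid(p^{r'}-1)$; it is known (Modisett) that then $(\mathrm{GF}(p^{r}),\Phi)$ is circular for every $r$ with $k\mid(p^{r}-1)$. -}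

module Defs where

open import Data.Nat using (ℕ; zero; suc; _≤_; _<_) renaming (_+_ to _+ℕ_; _*_ to _*ℕ_; _^_ to _^ℕ_; _∸_ to _∸ℕ_)
open import Data.Nat.Divisibility using (_∣_)
open import Data.List using (List; []; _∷_; length; filter; map; upTo; cartesianProduct)
open import Data.Nat.ListAction using (sum)
open import Data.List.Membership.Propositional using (_∈_)
open import Data.List.Relation.Unary.Unique.Propositional using (Unique)
open import Data.List.Relation.Unary.Any using (Any; any?)
open import Data.Product using (_×_; _,_; ∃; Σ)
open import Relation.Nullary using (¬_; Dec)
open import Relation.Nullary.Decidable using (_×-dec_)
open import Relation.Binary.PropositionalEquality using (_≡_)
open import Relation.Binary.Definitions using (DecidableEquality)
open import Algebra.Core using (Op₁; Op₂)
open import Algebra.Structures using (IsCommutativeRing)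

record FiniteField : Set₁ where
  infixl 6 _+_ _-_
  infixl 7 _*_
  field
    Carrier  : Set
    _+_ _*_  : Op₂ Carrier
    -_       : Op₁ Carrier
    0# 1#    : Carrier
    isCommutativeRing : IsCommutativeRing _≡_ _+_ _*_ -_ 0# 1#
    0≢1      : ¬ (0# ≡ 1#)
    inverse  : ∀ x → ¬ (x ≡ 0#) → ∃ λ y → x * y ≡ 1#
    _≟_      : DecidableEquality Carrier
    elements : List Carrier
    complete : ∀ x → x ∈ elements
    unique   : Unique elements

  _-_ : Op₂ Carrier
  x - y = x + (- y)

  _^_ : Carrier → ℕ → Carrier
  x ^ zero  = 1#
  x ^ suc n = x * (x ^ n)

  size : ℕ
  size = length elements

  count : {P : Carrier → Set} → ((x : Carrier) → Dec (P x)) → ℕ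
  count P? = length (filter P? elements)

  IsGenerator : Carrier → Set
  IsGenerator ζ = ∀ x → ¬ (x ≡ 0#) → ∃ λ i → ζ ^ i ≡ x

  HasOrder : Carrier → ℕ → Set
  HasOrder ψ k = (ψ ^ k ≡ 1#) × (∀ i → 0 < i → i < k → ¬ (ψ ^ i ≡ 1#))

  cyclic : Carrier → ℕ → List Carrier
  cyclic ψ k = map (ψ ^_) (upTo k)

  InMul : List Carrier → Carrier → Carrier → Set
  InMul S a x = Any (λ y → x ≡ y * a) S

  inMul? : ∀ S a x → Dec (InMul S a x)
  inMul? S a x = any? (λ y → x ≟ (y * a)) S

  InAdd : List Carrier → Carrier → Carrier → Set
  InAdd S c x = Any (λ y → x ≡ y + c) S

  inAdd? : ∀ S c x → Dec (InAdd S c x)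
  inAdd? S c x = any? (λ y → x ≟ (y + c)) S

  InMulAdd : List Carrier → Carrier → Carrier → Carrier → Set
  InMulAdd S b c x = Any (λ y → x ≡ y * b + c) S

  inMulAdd? : ∀ S b c x → Dec (InMulAdd S b c x)
  inMulAdd? S b c x = any? (λ y → x ≟ (y * b + c)) S

  interCount : List Carrier → Carrier → Carrier → Carrier → ℕ
  interCount S a b c = count (λ x → inMul? S a x ×-dec inMulAdd? S b c x)

  IsCircularPair : List Carrier → Set
  IsCircularPair S = ∀ a b c → ¬ (a ≡ 0#) → ¬ (b ≡ 0#) → ¬ (c ≡ 0#) →
                     interCount S a b c ≤ 2

open FiniteField public using (Carrier)

-- (p,k) is circular: for some r' with k ∣ p^r' - 1, the field GF(p^r')
-- together with its (unique) multiplicative subgroup Ψ of order k is circular.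
-- Ψ is given as ⟨ψ⟩ for an element ψ of order k.
CircularPK : ℕ → ℕ → Set₁
CircularPK p k =
  Σ ℕ λ r' → (k ∣ ((p ^ℕ r') ∸ℕ 1)) ×
  Σ FiniteField λ E → (FiniteField.size E ≡ p ^ℕ r') ×
  Σ (Carrier E) λ ψ → FiniteField.HasOrder E ψ k ×
  FiniteField.IsCircularPair E (FiniteField.cyclic E ψ k)

sValue : (F : FiniteField) → Carrier F → ℕ → ℕ
sValue F φ k = sum (map term (map suc (upTo (k ∸ℕ 1))))
  where
  open FiniteField F
  Φ = cyclic φ k
  term : ℕ → ℕ
  term j = count (λ x → inAdd? Φ 1# x ×-dec inAdd? Φ (φ ^ j) x)

tValue : (F : FiniteField) → Carrier F → ℕ → ℕ
tValue F φ k = count (λ x → any? (λ y → x ≟ y) Φ ×-dec inAdd? Φ 1# x)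
  where
  open FiniteField F
  Φ = cyclic φ k

fermatCount : (F : FiniteField) → ℕ → ℕ
fermatCount F m =
  length (filter (λ { (x , (y , z)) → ((x ^ m) + (y ^ m) - (z ^ m)) ≟ 1# })
                 (cartesianProduct elements (cartesianProduct elements elements)))
  where open FiniteField F

module Submission where

-- Group the solutions by (u, v, w) = (x^m, y^m, z^m). As x = ζ^i gives x^m = φ^i, the m-th power
-- map is m-to-1 from F* onto Φ = ⟨φ⟩ and fixes 0, so the count is a sum of [u + v − w = 1] over
-- u, v, w ∈ {0} ∪ Φ with weight m for each coordinate in Φ. Of the eight partial sums, the one with
-- u = v = w = 0 vanishes, the one with only w ∈ Φ is e = [−1 ∈ Φ], those with only u or only v in Φ
-- are 1, those with exactly one zero are t (after rescaling when w = 0), and the one with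
-- u, v, w ∈ Φ is k + s (v = 1 forces u = w, and v = φ^j gives the j-th term of s). Hence the count
-- is m³(k + s) + 3m²t + (2 + e)m. Finally −1 ∈ Φ when k is even (φ^(k/2) = −1) or −1 = 1 (p = 2),
-- while for odd p and odd k it is not, since then −1 ≠ 1 (q − 1 is even) but (−1)^k = −1.

open import Defs using (FiniteField; sValue; tValue; fermatCount)
open import Data.Nat using (ℕ; zero; suc; _≤_; _<_; z≤n; s≤s; NonZero; >-nonZero)
open import Data.Product using (_×_; _,_; ∃-syntax; proj₁; proj₂)
open import Data.Sum using (_⊎_; inj₁; inj₂)
open import Data.Empty using (⊥-elim)
open import Function using (_∘_; _⇔_; mk⇔; Equivalence)
open import Relation.Nullary using (¬_; Dec; yes; no)
open import Relation.Binary.PropositionalEquality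

module Sums where

  open import Data.Nat using (_+_; _*_; _∸_)
  open import Data.Nat.Properties
  open import Algebra.Properties.CommutativeSemigroup +-commutativeSemigroup using (interchange)
  open import Data.List using (List; []; _∷_; _++_; map; applyUpTo; filter; length; cartesianProduct)
  open import Data.Nat.ListAction using (sum)
  open import Data.List.Membership.Propositional using (_∈_)
  open import Data.List.Relation.Unary.Any using (here; there; any?)
  open import Data.List.Relation.Unary.All using (All; []; _∷_)
  open import Data.List.Relation.Unary.AllPairs using (_∷_)
  open import Data.List.Relation.Unary.Unique.Propositional using (Unique)
  open import Relation.Nullary.Decidable using (_×-dec_)
  open import Relation.Binary.Definitions using (DecidableEquality)

  χ : ∀ {ℓ} {P : Set ℓ} → Dec P → ℕ
  χ (yes _) = 1
  χ (no _)  = 0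

  module _ {ℓ} {P : Set ℓ} where

    χ-yes : P → (d : Dec P) → χ d ≡ 1
    χ-yes _  (yes _)  = refl
    χ-yes px (no ¬px) = ⊥-elim (¬px px)

    χ-no : ¬ P → (d : Dec P) → χ d ≡ 0
    χ-no ¬px (yes px) = ⊥-elim (¬px px)
    χ-no _   (no _)   = refl

    χ-cong : ∀ {ℓ′} {Q : Set ℓ′} → P ⇔ Q → (d : Dec P) (e : Dec Q) → χ d ≡ χ e
    χ-cong _   (yes _)  (yes _)  = refl
    χ-cong P⇔Q (yes px) (no ¬qx) = ⊥-elim (¬qx (Equivalence.to P⇔Q px))
    χ-cong P⇔Q (no ¬px) (yes qx) = ⊥-elim (¬px (Equivalence.from P⇔Q qx))
    χ-cong _   (no _)   (no _)   = refl

    χ-×-dec : ∀ {ℓ′} {Q : Set ℓ′} (d : Dec P) (e : Dec Q) → χ (d ×-dec e) ≡ χ d * χ e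
    χ-×-dec (yes _) (yes _) = refl
    χ-×-dec (yes _) (no _)  = refl
    χ-×-dec (no _)  _       = refl

  ∑< : ℕ → (ℕ → ℕ) → ℕ
  ∑< zero    f = 0
  ∑< (suc n) f = f 0 + ∑< n (f ∘ suc)

  syntax ∑< n (λ i → e) = ∑[ i < n ] e

  Periodic : ℕ → (ℕ → ℕ) → Set
  Periodic k f = ∀ i → f (k + i) ≡ f i

  ∑<-cong : ∀ n {f g : ℕ → ℕ} → (∀ i → i < n → f i ≡ g i) → ∑< n f ≡ ∑< n g
  ∑<-cong zero    _ = refl
  ∑<-cong (suc n) f≗g = cong₂ _+_ (f≗g 0 (s≤s z≤n)) (∑<-cong n (λ i i<n → f≗g (suc i) (s≤s i<n)))

  ∑<-distrib-+ : ∀ n (f g : ℕ → ℕ) → ∑[ i < n ] (f i + g i) ≡ ∑< n f + ∑< n g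
  ∑<-distrib-+ zero    f g = refl
  ∑<-distrib-+ (suc n) f g = trans (cong (f 0 + g 0 +_) (∑<-distrib-+ n (f ∘ suc) (g ∘ suc)))
                                   (interchange (f 0) (g 0) _ _)

  ∑<-distribˡ-* : ∀ n c (f : ℕ → ℕ) → ∑[ i < n ] (c * f i) ≡ c * ∑< n f
  ∑<-distribˡ-* zero    c f = sym (*-zeroʳ c)
  ∑<-distribˡ-* (suc n) c f = trans (cong (c * f 0 +_) (∑<-distribˡ-* n c (f ∘ suc)))
                                    (sym (*-distribˡ-+ c (f 0) _))

  ∑<-distribʳ-* : ∀ n c (f : ℕ → ℕ) → ∑[ i < n ] (f i * c) ≡ ∑< n f * c
  ∑<-distribʳ-* n c f = begin
    ∑[ i < n ] (f i * c) ≡⟨ ∑<-cong n (λ i _ → *-comm (f i) c) ⟩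
    ∑[ i < n ] (c * f i) ≡⟨ ∑<-distribˡ-* n c f ⟩
    c * ∑< n f           ≡⟨ *-comm c _ ⟩
    ∑< n f * c           ∎
    where open ≡-Reasoning

  ∑<-const : ∀ n c → ∑[ _ < n ] c ≡ n * c
  ∑<-const zero    c = refl
  ∑<-const (suc n) c = cong (c +_) (∑<-const n c)

  ∑<-zero : ∀ n {f : ℕ → ℕ} → (∀ i → i < n → f i ≡ 0) → ∑< n f ≡ 0
  ∑<-zero n f≗0 = trans (∑<-cong n f≗0) (trans (∑<-const n 0) (*-zeroʳ n))

  ∑<-front : ∀ {n} (f : ℕ → ℕ) → 0 < n → ∑< n f ≡ f 0 + ∑[ i < n ∸ 1 ] f (suc i)
  ∑<-front {suc n} f _ = refl

  ∑<-suc : ∀ n (f : ℕ → ℕ) → ∑< (suc n) f ≡ ∑< n f + f n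
  ∑<-suc zero    f = +-comm (f 0) 0
  ∑<-suc (suc n) f = trans (cong (f 0 +_) (∑<-suc n (f ∘ suc))) (sym (+-assoc (f 0) _ _))

  ∑<-+ : ∀ a b (f : ℕ → ℕ) → ∑< (a + b) f ≡ ∑< a f + ∑[ i < b ] f (a + i)
  ∑<-+ zero    b f = refl
  ∑<-+ (suc a) b f = trans (cong (f 0 +_) (∑<-+ a b (f ∘ suc))) (sym (+-assoc (f 0) _ _))

  ∑<-comm : ∀ n m (f : ℕ → ℕ → ℕ) → ∑[ i < n ] ∑[ j < m ] f i j ≡ ∑[ j < m ] ∑[ i < n ] f i j
  ∑<-comm zero    m f = sym (∑<-zero m (λ _ _ → refl))
  ∑<-comm (suc n) m f = trans (cong (∑< m (f 0) +_) (∑<-comm n m (f ∘ suc)))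
                              (sym (∑<-distrib-+ m (f 0) _))

  ∑<-term : ∀ n (f : ℕ → ℕ) i → i < n → f i ≤ ∑< n f
  ∑<-term (suc n) f zero    _         = m≤m+n (f 0) _
  ∑<-term (suc n) f (suc i) (s≤s i<n) = ≤-trans (∑<-term n (f ∘ suc) i i<n) (m≤n+m _ (f 0))

  ∑<-χ-none : ∀ n {q} {Q : ℕ → Set q} (Q? : ∀ i → Dec (Q i)) → (∀ i → i < n → ¬ Q i) →
              ∑[ i < n ] χ (Q? i) ≡ 0
  ∑<-χ-none n Q? ¬Q = ∑<-zero n (λ i i<n → χ-no (¬Q i i<n) (Q? i))

  ∑<-χ-≤1 : ∀ n {q} {Q : ℕ → Set q} (Q? : ∀ i → Dec (Q i)) →
            (∀ i j → i < n → j < n → Q i → Q j → i ≡ j) → ∑[ i < n ] χ (Q? i) ≤ 1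
  ∑<-χ-≤1 zero    Q? _ = z≤n
  ∑<-χ-≤1 (suc n) Q? Q-unique with Q? 0
  ... | yes q₀ = ≤-reflexive (cong suc (∑<-χ-none n (Q? ∘ suc)
                   (λ i i<n qᵢ → 1+n≢0 (Q-unique (suc i) 0 (s≤s i<n) (s≤s z≤n) qᵢ q₀))))
  ... | no _   = ∑<-χ-≤1 n (Q? ∘ suc) (λ i j i<n j<n qᵢ qⱼ →
                   suc-injective (Q-unique (suc i) (suc j) (s≤s i<n) (s≤s j<n) qᵢ qⱼ))

  ∑<-select : ∀ n {q} {Q : ℕ → Set q} (Q? : ∀ i → Dec (Q i)) (c : ℕ → ℕ) i₀ → i₀ < n → Q i₀ →
              (∀ i → i < n → Q i → i ≡ i₀) → ∑[ i < n ] (χ (Q? i) * c i) ≡ c i₀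
  ∑<-select (suc n) Q? c zero _ q₀ unique = begin
    χ (Q? 0) * c 0 + ∑[ i < n ] (χ (Q? (suc i)) * c (suc i))
      ≡⟨ cong₂ _+_ (cong (_* c 0) (χ-yes q₀ (Q? 0)))
                   (∑<-zero n (λ i i<n → cong (_* c (suc i))
                     (χ-no (λ qᵢ → 1+n≢0 (unique (suc i) (s≤s i<n) qᵢ)) (Q? (suc i))))) ⟩
    1 * c 0 + 0 ≡⟨ +-identityʳ _ ⟩
    1 * c 0     ≡⟨ *-identityˡ _ ⟩
    c 0         ∎
    where open ≡-Reasoning
  ∑<-select (suc n) Q? c (suc i₀) (s≤s i₀<n) q₀ unique =
    trans (cong (λ z → z * c 0 + ∑[ i < n ] (χ (Q? (suc i)) * c (suc i)))
                (χ-no (λ q → 1+n≢0 (sym (unique 0 (s≤s z≤n) q))) (Q? 0)))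
          (∑<-select n (Q? ∘ suc) (c ∘ suc) i₀ i₀<n q₀
            (λ i i<n qᵢ → suc-injective (unique (suc i) (s≤s i<n) qᵢ)))

  ∑<-χ-unique : ∀ n {q} {Q : ℕ → Set q} (Q? : ∀ i → Dec (Q i)) i₀ → i₀ < n → Q i₀ →
                (∀ i → i < n → Q i → i ≡ i₀) → ∑[ i < n ] χ (Q? i) ≡ 1
  ∑<-χ-unique n Q? i₀ i₀<n q₀ unique =
    trans (∑<-cong n (λ i _ → sym (*-identityʳ (χ (Q? i))))) (∑<-select n Q? (λ _ → 1) i₀ i₀<n q₀ unique)

  ∑<-periodic : ∀ k m (f : ℕ → ℕ) → Periodic k f → ∑< (k * m) f ≡ m * ∑< k f
  ∑<-periodic k zero    f _   rewrite *-zeroʳ k = refl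
  ∑<-periodic k (suc m) f per rewrite *-suc k m =
    trans (∑<-+ k (k * m) f) (cong (∑< k f +_) (trans (∑<-cong (k * m) (λ i _ → per i)) (∑<-periodic k m f per)))

  ∑<-rotate : ∀ k b (f : ℕ → ℕ) → Periodic k f → ∑[ i < k ] f (b + i) ≡ ∑< k f
  ∑<-rotate k zero    f per = refl
  ∑<-rotate k (suc b) f per = begin
    ∑[ i < k ] f (suc b + i)  ≡⟨ ∑<-cong k (λ i _ → cong f (sym (+-suc b i))) ⟩
    ∑[ i < k ] f (b + suc i)  ≡⟨ +-cancelˡ-≡ (f (b + 0)) _ _ shift ⟩
    ∑[ i < k ] f (b + i)      ≡⟨ ∑<-rotate k b f per ⟩
    ∑< k f                    ∎
    where
    open ≡-Reasoning
    wrap : f (b + k) ≡ f (b + 0)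
    wrap = trans (cong f (+-comm b k)) (trans (per b) (cong f (sym (+-identityʳ b))))
    shift : f (b + 0) + ∑[ i < k ] f (b + suc i) ≡ f (b + 0) + ∑[ i < k ] f (b + i)
    shift = trans (∑<-suc k (λ i → f (b + i)))
                  (trans (cong (∑[ i < k ] f (b + i) +_) wrap) (+-comm (∑[ i < k ] f (b + i)) (f (b + 0))))

  ∑<-reflect : ∀ k (f : ℕ → ℕ) → Periodic k f → ∑[ i < k ] f (k ∸ i) ≡ ∑< k f
  ∑<-reflect k f per = trans (reversed k f) (∑<-rotate k 1 f per)
    where
    reversed : ∀ n (g : ℕ → ℕ) → ∑[ i < n ] g (n ∸ i) ≡ ∑[ i < n ] g (suc i)
    reversed zero    g = refl
    reversed (suc n) g = begin
      g (suc n) + ∑[ i < n ] g (n ∸ i) ≡⟨ cong (g (suc n) +_) (reversed n g) ⟩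
      g (suc n) + ∑[ i < n ] g (suc i) ≡⟨ +-comm (g (suc n)) _ ⟩
      ∑[ i < n ] g (suc i) + g (suc n) ≡⟨ sym (∑<-suc n (g ∘ suc)) ⟩
      ∑[ i < suc n ] g (suc i)         ∎
      where open ≡-Reasoning

  module _ {a} {A : Set a} where

    ∑∈ : List A → (A → ℕ) → ℕ
    ∑∈ []       f = 0
    ∑∈ (x ∷ xs) f = f x + ∑∈ xs f

    syntax ∑∈ xs (λ x → e) = ∑[ x ∈ xs ] e

    ∑∈-cong : ∀ xs {f g : A → ℕ} → (∀ x → f x ≡ g x) → ∑∈ xs f ≡ ∑∈ xs g
    ∑∈-cong []       _   = refl
    ∑∈-cong (x ∷ xs) f≗g = cong₂ _+_ (f≗g x) (∑∈-cong xs f≗g)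

    ∑∈-distrib-+ : ∀ xs (f g : A → ℕ) → ∑[ x ∈ xs ] (f x + g x) ≡ ∑∈ xs f + ∑∈ xs g
    ∑∈-distrib-+ []       f g = refl
    ∑∈-distrib-+ (x ∷ xs) f g = trans (cong (f x + g x +_) (∑∈-distrib-+ xs f g)) (interchange (f x) (g x) _ _)

    ∑∈-mono : ∀ xs {f g : A → ℕ} → (∀ x → f x ≤ g x) → ∑∈ xs f ≤ ∑∈ xs g
    ∑∈-mono []       _   = z≤n
    ∑∈-mono (x ∷ xs) f≤g = +-mono-≤ (f≤g x) (∑∈-mono xs f≤g)

    ∑∈-const-1 : ∀ xs → ∑[ _ ∈ xs ] 1 ≡ length xs
    ∑∈-const-1 []       = refl
    ∑∈-const-1 (_ ∷ xs) = cong suc (∑∈-const-1 xs)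

    ∑∈-∑<-comm : ∀ xs n (f : A → ℕ → ℕ) → ∑[ x ∈ xs ] ∑[ i < n ] f x i ≡ ∑[ i < n ] ∑[ x ∈ xs ] f x i
    ∑∈-∑<-comm []       n f = sym (∑<-zero n (λ _ _ → refl))
    ∑∈-∑<-comm (x ∷ xs) n f = trans (cong (∑< n (f x) +_) (∑∈-∑<-comm xs n f)) (sym (∑<-distrib-+ n (f x) _))

    ∑∈-++ : ∀ xs ys (f : A → ℕ) → ∑∈ (xs ++ ys) f ≡ ∑∈ xs f + ∑∈ ys f
    ∑∈-++ []       ys f = refl
    ∑∈-++ (x ∷ xs) ys f = trans (cong (f x +_) (∑∈-++ xs ys f)) (sym (+-assoc (f x) _ _))

    length-filter : ∀ {p} {P : A → Set p} (P? : ∀ x → Dec (P x)) xs →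
                    length (filter P? xs) ≡ ∑[ x ∈ xs ] χ (P? x)
    length-filter P? []       = refl
    length-filter P? (x ∷ xs) with P? x
    ... | yes _ = cong suc (length-filter P? xs)
    ... | no _  = length-filter P? xs

    ∑∈-select : (_≟_ : DecidableEquality A) → ∀ xs y (g : A → ℕ) → Unique xs → y ∈ xs →
                ∑[ x ∈ xs ] (χ (x ≟ y) * g x) ≡ g y
    ∑∈-select _≟_ (x ∷ xs) y g (x∉xs ∷ _) (here refl) = begin
      χ (x ≟ x) * g x + ∑[ z ∈ xs ] (χ (z ≟ x) * g z) ≡⟨ cong₂ _+_ (cong (_* g x) (χ-yes refl (x ≟ x))) (others xs x∉xs) ⟩
      1 * g x + 0                                      ≡⟨ +-identityʳ _ ⟩
      1 * g x                                          ≡⟨ *-identityˡ _ ⟩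
      g x                                              ∎
      where
      open ≡-Reasoning
      others : ∀ zs → All (x ≢_) zs → ∑[ z ∈ zs ] (χ (z ≟ x) * g z) ≡ 0
      others []       []            = refl
      others (z ∷ zs) (x≢z ∷ x∉zs) = cong₂ _+_ (cong (_* g z) (χ-no (x≢z ∘ sym) (z ≟ x))) (others zs x∉zs)
    ∑∈-select _≟_ (x ∷ xs) y g (x∉xs ∷ unique) (there y∈xs) =
      trans (cong (λ c → c * g x + ∑[ z ∈ xs ] (χ (z ≟ y) * g z)) (χ-no (x≢y x∉xs y∈xs) (x ≟ y)))
            (∑∈-select _≟_ xs y g unique y∈xs)
      where
      x≢y : ∀ {zs} → All (x ≢_) zs → y ∈ zs → x ≢ y
      x≢y (x≢z ∷ _)    (here refl) = x≢z
      x≢y (_ ∷ x∉zs) (there y∈zs) = x≢y x∉zs y∈zs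

  ∑∈-map : ∀ {a b} {A : Set a} {B : Set b} (g : A → B) xs (f : B → ℕ) → ∑∈ (map g xs) f ≡ ∑∈ xs (f ∘ g)
  ∑∈-map g []       f = refl
  ∑∈-map g (x ∷ xs) f = cong (f (g x) +_) (∑∈-map g xs f)

  ∑∈-cartesianProduct : ∀ {a b} {A : Set a} {B : Set b} (xs : List A) (ys : List B) (f : A × B → ℕ) →
                        ∑∈ (cartesianProduct xs ys) f ≡ ∑[ x ∈ xs ] ∑[ y ∈ ys ] f (x , y)
  ∑∈-cartesianProduct []       ys f = refl
  ∑∈-cartesianProduct (x ∷ xs) ys f =
    trans (∑∈-++ (map (x ,_) ys) _ f) (cong₂ _+_ (∑∈-map (x ,_) ys f) (∑∈-cartesianProduct xs ys f))

  ∑∈-applyUpTo : ∀ {a} {A : Set a} (g : ℕ → A) n (f : A → ℕ) → ∑∈ (applyUpTo g n) f ≡ ∑[ i < n ] f (g i)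
  ∑∈-applyUpTo g zero    f = refl
  ∑∈-applyUpTo g (suc n) f = cong (f (g 0) +_) (∑∈-applyUpTo (g ∘ suc) n f)

  sum-map : ∀ {a} {A : Set a} (xs : List A) (f : A → ℕ) → sum (map f xs) ≡ ∑∈ xs f
  sum-map []       f = refl
  sum-map (x ∷ xs) f = cong (f x +_) (sum-map xs f)

  χ-any-applyUpTo : ∀ {a p} {A : Set a} {P : A → Set p} (P? : ∀ x → Dec (P x)) (h : ℕ → A) n →
                    (∀ i j → i < n → j < n → P (h i) → P (h j) → i ≡ j) →
                    χ (any? P? (applyUpTo h n)) ≡ ∑[ i < n ] χ (P? (h i))
  χ-any-applyUpTo P? h zero    _      = refl
  χ-any-applyUpTo P? h (suc n) unique with P? (h 0)
  ... | yes p₀ = cong suc (sym (∑<-χ-none n (P? ∘ h ∘ suc)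
                   (λ i i<n pᵢ → 1+n≢0 (unique (suc i) 0 (s≤s i<n) (s≤s z≤n) pᵢ p₀))))
  ... | no ¬p₀ = trans (χ-cong (mk⇔ (λ { (here p₀) → ⊥-elim (¬p₀ p₀) ; (there q) → q }) there) _ _)
                   (χ-any-applyUpTo P? (h ∘ suc) n (λ i j i<n j<n pᵢ pⱼ →
                     suc-injective (unique (suc i) (suc j) (s≤s i<n) (s≤s j<n) pᵢ pⱼ)))

open Sums

module Parity where

  open import Data.Nat using (_*_; _^_; nonTrivial⇒n>1)
  open import Data.Nat.Properties using (+-comm; <⇒≢; ≤∧≢⇒<; m<m*n)
  open import Data.Nat.Divisibility using (_∣_; _∣0; ∣-refl; ∣1⇒≡1; ∣m∣n⇒∣m+n; ∣m+n∣m⇒∣n; m∣m*n; >⇒∤)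
  open import Data.Nat.Primality using (Prime; euclidsLemma; prime⇒nonTrivial; prime⇒¬composite; composite; prime[2])

  2∣⊎2∣suc : ∀ n → 2 ∣ n ⊎ 2 ∣ suc n
  2∣⊎2∣suc zero = inj₁ (2 ∣0)
  2∣⊎2∣suc (suc n) with 2∣⊎2∣suc n
  ... | inj₁ 2∣n   = inj₂ (∣m∣n⇒∣m+n ∣-refl 2∣n)
  ... | inj₂ 2∣1+n = inj₁ 2∣1+n

  2∣⇒2∤suc : ∀ {n} → 2 ∣ n → ¬ 2 ∣ suc n
  2∣⇒2∤suc {n} 2∣n 2∣1+n with ∣1⇒≡1 (∣m+n∣m⇒∣n (subst (2 ∣_) (+-comm 1 n) 2∣1+n) 2∣n)
  ... | ()

  prime∤^ : ∀ {d p} → Prime d → ¬ d ∣ p → ∀ r → ¬ d ∣ p ^ r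
  prime∤^ {d} pr _   zero    d∣1 = <⇒≢ (nonTrivial⇒n>1 d {{prime⇒nonTrivial pr}}) (sym (∣1⇒≡1 d∣1))
  prime∤^ {p = p} pr d∤p (suc r) d∣p^r+1 with euclidsLemma p (p ^ r) pr d∣p^r+1
  ... | inj₁ d∣p   = d∤p d∣p
  ... | inj₂ d∣p^r = prime∤^ pr d∤p r d∣p^r

  2∣pred-odd-prime^ : ∀ {p r n} → Prime p → p ≢ 2 → p ^ r ≡ suc n → 2 ∣ n
  2∣pred-odd-prime^ {p} {r} {n} pr p≢2 p^r≡1+n with 2∣⊎2∣suc n
  ... | inj₁ 2∣n   = 2∣n
  ... | inj₂ 2∣1+n = ⊥-elim (prime∤^ prime[2] 2∤p r (subst (2 ∣_) (sym p^r≡1+n) 2∣1+n))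
    where
    2∤p : ¬ 2 ∣ p
    2∤p 2∣p = prime⇒¬composite pr (composite (≤∧≢⇒< (nonTrivial⇒n>1 p {{prime⇒nonTrivial pr}}) (p≢2 ∘ sym)) 2∣p)

  2∤pred-2^ : ∀ {r n} → 2 ^ r ≡ suc n → 0 < n → ¬ 2 ∣ n
  2∤pred-2^ {zero}  refl ()
  2∤pred-2^ {suc r} 2^r+1≡1+n _ 2∣n = 2∣⇒2∤suc 2∣n (subst (2 ∣_) 2^r+1≡1+n (m∣m*n (2 ^ r)))

  half-bounds : ∀ {n h} → 0 < n → n ≡ h * 2 → 0 < h × h < n
  half-bounds {h = zero}  0<n refl = ⊥-elim (<⇒≢ 0<n refl)
  half-bounds {h = suc h} _   refl = s≤s z≤n , m<m*n (suc h) 2 (s≤s (s≤s z≤n))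

  ∣∧<⇒≡0 : ∀ {n i} → n ∣ i → i < n → i ≡ 0
  ∣∧<⇒≡0 {i = zero}  _   _   = refl
  ∣∧<⇒≡0 {i = suc _} n∣i i<n = ⊥-elim (>⇒∤ i<n n∣i)

module FieldLemmas (F : FiniteField) where

  open import Data.Nat using () renaming (_+_ to _+ℕ_; _*_ to _*ℕ_)
  import Data.Nat.Properties as ℕ
  open import Data.Nat.Divisibility using (_∣_; divides; ∣m∣n⇒∣m+n; ∣-refl)
  open import Relation.Nullary.Decidable using (¬?)
  open import Algebra.Bundles using (CommutativeRing)
  open import Algebra.Structures using (IsCommutativeRing)
  open FiniteField F
  open IsCommutativeRing isCommutativeRing
    using ( +-identityˡ; +-identityʳ; +-assoc; +-comm; -‿inverseˡ; -‿inverseʳ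
          ; *-identityˡ; *-identityʳ; *-assoc; *-comm; zeroˡ; zeroʳ; distribˡ; distribʳ)

  commutativeRing : CommutativeRing _ _
  commutativeRing = record { isCommutativeRing = isCommutativeRing }

  open import Algebra.Properties.Ring (CommutativeRing.ring commutativeRing)
    using (-‿involutive; -0#≈0#; +-cancelʳ; +-inverseˡ-unique; -1*x≈-x)

  open ≡-Reasoning

  x-y≡1⇔x≡y+1 : ∀ {x y} → x - y ≡ 1# ⇔ x ≡ y + 1#
  x-y≡1⇔x≡y+1 {x} {y} = mk⇔ to from
    where
    to : x - y ≡ 1# → x ≡ y + 1#
    to x-y≡1 = begin
      x             ≡⟨ sym (+-identityʳ x) ⟩
      x + 0#        ≡⟨ cong (x +_) (sym (-‿inverseˡ y)) ⟩
      x + (- y + y) ≡⟨ sym (+-assoc x (- y) y) ⟩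
      x - y + y     ≡⟨ cong (_+ y) x-y≡1 ⟩
      1# + y        ≡⟨ +-comm 1# y ⟩
      y + 1#        ∎
    from : x ≡ y + 1# → x - y ≡ 1#
    from refl = begin
      y + 1# - y      ≡⟨ cong (_- y) (+-comm y 1#) ⟩
      1# + y - y      ≡⟨ +-assoc 1# y (- y) ⟩
      1# + (y - y)    ≡⟨ cong (1# +_) (-‿inverseʳ y) ⟩
      1# + 0#         ≡⟨ +-identityʳ 1# ⟩
      1#              ∎

  0≡x+1⇔x≡-1 : ∀ {x} → 0# ≡ x + 1# ⇔ x ≡ - 1#
  0≡x+1⇔x≡-1 {x} = mk⇔ (λ 0≡x+1 → +-inverseˡ-unique x 1# (sym 0≡x+1))
                        (λ { refl → sym (-‿inverseˡ 1#) })

  -1≢0 : - 1# ≢ 0#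
  -1≢0 -1≡0 = 0≢1 (sym (trans (sym (-‿involutive 1#)) (trans (cong -_ -1≡0) -0#≈0#)))

  *-cancelˡ : ∀ x {y z} → x ≢ 0# → x * y ≡ x * z → y ≡ z
  *-cancelˡ x {y} {z} x≢0 xy≡xz with inverse x x≢0
  ... | x⁻¹ , xx⁻¹≡1 = begin
    y              ≡⟨ sym (*-identityˡ y) ⟩
    1# * y         ≡⟨ cong (_* y) x⁻¹x≡1 ⟨
    x⁻¹ * x * y    ≡⟨ *-assoc x⁻¹ x y ⟩
    x⁻¹ * (x * y)  ≡⟨ cong (x⁻¹ *_) xy≡xz ⟩
    x⁻¹ * (x * z)  ≡⟨ *-assoc x⁻¹ x z ⟨
    x⁻¹ * x * z    ≡⟨ cong (_* z) x⁻¹x≡1 ⟩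
    1# * z         ≡⟨ *-identityˡ z ⟩
    z              ∎
    where
    x⁻¹x≡1 : x⁻¹ * x ≡ 1#
    x⁻¹x≡1 = trans (*-comm x⁻¹ x) xx⁻¹≡1

  *-zero-split : ∀ x y → x * y ≡ 0# → x ≡ 0# ⊎ y ≡ 0#
  *-zero-split x y xy≡0 with x ≟ 0#
  ... | yes x≡0 = inj₁ x≡0
  ... | no  x≢0 = inj₂ (*-cancelˡ x x≢0 (trans xy≡0 (sym (zeroʳ x))))

  *-nonzero : ∀ {x y} → x ≢ 0# → y ≢ 0# → x * y ≢ 0#
  *-nonzero x≢0 y≢0 xy≡0 with *-zero-split _ _ xy≡0
  ... | inj₁ x≡0 = x≢0 x≡0
  ... | inj₂ y≡0 = y≢0 y≡0

  x*x≡1⇒x≡±1 : ∀ x → x * x ≡ 1# → x ≡ 1# ⊎ x ≡ - 1#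
  x*x≡1⇒x≡±1 x xx≡1 with *-zero-split (x + 1#) (x - 1#) [x+1][x-1]≡0
    where
    [x+1][x-1]≡0 : (x + 1#) * (x - 1#) ≡ 0#
    [x+1][x-1]≡0 = begin
      (x + 1#) * (x - 1#)                 ≡⟨ distribʳ (x - 1#) x 1# ⟩
      x * (x - 1#) + 1# * (x - 1#)        ≡⟨ cong₂ _+_ (distribˡ x x (- 1#)) (*-identityˡ (x - 1#)) ⟩
      x * x + x * - 1# + (x - 1#)         ≡⟨ cong₂ (λ a b → a + b + (x - 1#)) xx≡1 (trans (*-comm x (- 1#)) (-1*x≈-x x)) ⟩
      1# + - x + (x - 1#)                 ≡⟨ +-assoc 1# (- x) (x - 1#) ⟩
      1# + (- x + (x - 1#))               ≡⟨ cong (1# +_) (+-assoc (- x) x (- 1#)) ⟨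
      1# + (- x + x - 1#)                 ≡⟨ cong (λ a → 1# + (a - 1#)) (-‿inverseˡ x) ⟩
      1# + (0# - 1#)                      ≡⟨ cong (1# +_) (+-identityˡ (- 1#)) ⟩
      1# - 1#                             ≡⟨ -‿inverseʳ 1# ⟩
      0#                                  ∎
  ... | inj₁ x+1≡0 = inj₂ (+-inverseˡ-unique x 1# x+1≡0)
  ... | inj₂ x-1≡0 = inj₁ (+-cancelʳ (- 1#) x 1# (trans x-1≡0 (sym (-‿inverseʳ 1#))))

  ^-+ : ∀ x i j → x ^ (i +ℕ j) ≡ x ^ i * x ^ j
  ^-+ x zero    j = sym (*-identityˡ _)
  ^-+ x (suc i) j = trans (cong (x *_) (^-+ x i j)) (sym (*-assoc x _ _))

  ^-* : ∀ x i j → x ^ (i *ℕ j) ≡ (x ^ i) ^ j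
  ^-* x i zero    rewrite ℕ.*-zeroʳ i = refl
  ^-* x i (suc j) rewrite ℕ.*-suc i j = trans (^-+ x i (i *ℕ j)) (cong (x ^ i *_) (^-* x i j))

  ^-comm : ∀ x i j → (x ^ i) ^ j ≡ (x ^ j) ^ i
  ^-comm x i j = trans (sym (^-* x i j)) (trans (cong (x ^_) (ℕ.*-comm i j)) (^-* x j i))

  1^ : ∀ n → 1# ^ n ≡ 1#
  1^ zero    = refl
  1^ (suc n) = trans (*-identityˡ _) (1^ n)

  0^ : ∀ {n} → 0 < n → 0# ^ n ≡ 0#
  0^ {suc n} _ = zeroˡ _

  ^-nonzero : ∀ {x} n → x ≢ 0# → x ^ n ≢ 0#
  ^-nonzero zero    _   1≡0 = 0≢1 (sym 1≡0)
  ^-nonzero (suc n) x≢0     = *-nonzero x≢0 (^-nonzero n x≢0)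

  -1*-1≡1 : - 1# * - 1# ≡ 1#
  -1*-1≡1 = trans (-1*x≈-x (- 1#)) (-‿involutive 1#)

  -1^-odd : ∀ n → ¬ 2 ∣ n → (- 1#) ^ n ≡ - 1#
  -1^-odd zero          2∤0 = ⊥-elim (2∤0 (divides 0 refl))
  -1^-odd (suc zero)    _   = *-identityʳ (- 1#)
  -1^-odd (suc (suc n)) 2∤n+2 = begin
    - 1# * (- 1# * (- 1#) ^ n) ≡⟨ *-assoc (- 1#) (- 1#) _ ⟨
    - 1# * - 1# * (- 1#) ^ n   ≡⟨ cong (_* (- 1#) ^ n) -1*-1≡1 ⟩
    1# * (- 1#) ^ n            ≡⟨ *-identityˡ _ ⟩
    (- 1#) ^ n                 ≡⟨ -1^-odd n (2∤n+2 ∘ ∣m∣n⇒∣m+n ∣-refl) ⟩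
    - 1#                       ∎

  χ-≟-cong : ∀ {a a′ b b′} → a ≡ a′ → b ≡ b′ → χ (a ≟ b) ≡ χ (a′ ≟ b′)
  χ-≟-cong refl refl = refl

  nonzero? : ∀ x → Dec (x ≢ 0#)
  nonzero? x = ¬? (x ≟ 0#)

  ∑-select : ∀ y (g : Carrier → ℕ) → ∑[ x ∈ elements ] (χ (x ≟ y) *ℕ g x) ≡ g y
  ∑-select y g = ∑∈-select _≟_ elements y g unique (complete y)

  ∑-χ-≟ : ∀ y → ∑[ x ∈ elements ] χ (x ≟ y) ≡ 1
  ∑-χ-≟ y = trans (∑∈-cong elements (λ x → sym (ℕ.*-identityʳ (χ (x ≟ y))))) (∑-select y (λ _ → 1))

  count-nonzero : ∑[ x ∈ elements ] χ (nonzero? x) +ℕ 1 ≡ size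
  count-nonzero = begin
    ∑[ x ∈ elements ] χ (nonzero? x) +ℕ 1
      ≡⟨ cong (∑[ x ∈ elements ] χ (nonzero? x) +ℕ_) (∑-χ-≟ 0#) ⟨
    ∑[ x ∈ elements ] χ (nonzero? x) +ℕ ∑[ x ∈ elements ] χ (x ≟ 0#)
      ≡⟨ ∑∈-distrib-+ elements _ _ ⟨
    ∑[ x ∈ elements ] (χ (nonzero? x) +ℕ χ (x ≟ 0#))
      ≡⟨ ∑∈-cong elements exactly-one ⟩
    ∑[ _ ∈ elements ] 1
      ≡⟨ ∑∈-const-1 elements ⟩
    size ∎
    where
    exactly-one : ∀ x → χ (nonzero? x) +ℕ χ (x ≟ 0#) ≡ 1
    exactly-one x with x ≟ 0#
    ... | yes _ = refl
    ... | no _  = refl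

  2≤size : 2 ≤ size
  2≤size = subst (2 ≤_) count-nonzero
    (ℕ.+-monoˡ-≤ 1 (ℕ.≤-trans (ℕ.≤-reflexive (sym (∑-χ-≟ 1#))) (∑∈-mono elements one-is-nonzero)))
    where
    one-is-nonzero : ∀ x → χ (x ≟ 1#) ≤ χ (nonzero? x)
    one-is-nonzero x with x ≟ 1#
    ... | no _     = z≤n
    ... | yes refl = ℕ.≤-reflexive (sym (χ-yes (λ 1≡0 → 0≢1 (sym 1≡0)) (nonzero? 1#)))

module Powers (F : FiniteField) where

  open import Data.Nat using () renaming (_+_ to _+ℕ_; _*_ to _*ℕ_; _∸_ to _∸ℕ_)
  import Data.Nat.Properties as ℕ
  open import Data.Nat.DivMod using (_%_; _/_; m≡m%n+[m/n]*n; m%n<n)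
  open import Data.Nat.Divisibility using (_∣_; m%n≡0⇒n∣m)
  open import Relation.Binary.Definitions using (tri<; tri≈; tri>)
  open import Algebra.Structures using (IsCommutativeRing)
  open FiniteField F
  open FieldLemmas F
  open IsCommutativeRing isCommutativeRing using (*-identityˡ; *-identityʳ; *-comm)
  open ≡-Reasoning

  ^≡1⇒≢0 : ∀ {ψ} K → ψ ^ suc K ≡ 1# → ψ ≢ 0#
  ^≡1⇒≢0 K ψ^K≡1 ψ≡0 = 0≢1 (trans (sym (0^ {suc K} (s≤s z≤n))) (trans (cong (_^ suc K) (sym ψ≡0)) ψ^K≡1))

  ^-periodic : ∀ {ψ K} → ψ ^ K ≡ 1# → ∀ i → ψ ^ (K +ℕ i) ≡ ψ ^ i
  ^-periodic {ψ} {K} ψ^K≡1 i = trans (^-+ ψ K i) (trans (cong (_* ψ ^ i) ψ^K≡1) (*-identityˡ _))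

  ^-mod : ∀ {ψ} K .{{_ : NonZero K}} → ψ ^ K ≡ 1# → ∀ i → ψ ^ i ≡ ψ ^ (i % K)
  ^-mod {ψ} K ψ^K≡1 i = begin
    ψ ^ i                                  ≡⟨ cong (ψ ^_) (m≡m%n+[m/n]*n i K) ⟩
    ψ ^ (i % K +ℕ (i / K) *ℕ K)            ≡⟨ ^-+ ψ (i % K) _ ⟩
    ψ ^ (i % K) * ψ ^ ((i / K) *ℕ K)       ≡⟨ cong (λ e → ψ ^ (i % K) * ψ ^ e) (ℕ.*-comm (i / K) K) ⟩
    ψ ^ (i % K) * ψ ^ (K *ℕ (i / K))       ≡⟨ cong (ψ ^ (i % K) *_) (^-* ψ K (i / K)) ⟩
    ψ ^ (i % K) * (ψ ^ K) ^ (i / K)        ≡⟨ cong (λ y → ψ ^ (i % K) * y ^ (i / K)) ψ^K≡1 ⟩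
    ψ ^ (i % K) * 1# ^ (i / K)             ≡⟨ cong (ψ ^ (i % K) *_) (1^ (i / K)) ⟩
    ψ ^ (i % K) * 1#                       ≡⟨ *-identityʳ _ ⟩
    ψ ^ (i % K)                            ∎

  ^-gap : ∀ {ψ a b} → ψ ≢ 0# → a ≤ b → ψ ^ a ≡ ψ ^ b → ψ ^ (b ∸ℕ a) ≡ 1#
  ^-gap {ψ} {a} {b} ψ≢0 a≤b ψ^a≡ψ^b = sym (*-cancelˡ (ψ ^ a) (^-nonzero a ψ≢0) (begin
    ψ ^ a * 1#              ≡⟨ *-identityʳ _ ⟩
    ψ ^ a                   ≡⟨ ψ^a≡ψ^b ⟩
    ψ ^ b                   ≡⟨ cong (ψ ^_) (ℕ.m+[n∸m]≡n a≤b) ⟨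
    ψ ^ (a +ℕ (b ∸ℕ a))     ≡⟨ ^-+ ψ a (b ∸ℕ a) ⟩
    ψ ^ a * ψ ^ (b ∸ℕ a)    ∎))

  module _ {ψ} K (ψ≢0 : ψ ≢ 0#) (no-small-order : ∀ d → 0 < d → d < K → ψ ^ d ≢ 1#) where

    ^-<-distinct : ∀ {a b} → a < b → b < K → ψ ^ a ≢ ψ ^ b
    ^-<-distinct {a} {b} a<b b<K ψ^a≡ψ^b = no-small-order (b ∸ℕ a) (ℕ.m<n⇒0<n∸m a<b)
      (ℕ.≤-<-trans (ℕ.m∸n≤m b a) b<K) (^-gap ψ≢0 (ℕ.<⇒≤ a<b) ψ^a≡ψ^b)

    ^-injective : ∀ {i j} → i < K → j < K → ψ ^ i ≡ ψ ^ j → i ≡ j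
    ^-injective {i} {j} i<K j<K ψ^i≡ψ^j with ℕ.<-cmp i j
    ... | tri≈ _ i≡j _ = i≡j
    ... | tri< i<j _ _ = ⊥-elim (^-<-distinct i<j j<K ψ^i≡ψ^j)
    ... | tri> _ _ j<i = ⊥-elim (^-<-distinct j<i i<K (sym ψ^i≡ψ^j))

  order-injective : ∀ {ψ K i j} → HasOrder ψ K → i < K → j < K → ψ ^ i ≡ ψ ^ j → i ≡ j
  order-injective {K = suc K} (ψ^K≡1 , minimal) = ^-injective (suc K) (^≡1⇒≢0 K ψ^K≡1) minimal

  order-∣ : ∀ {ψ K e} .{{_ : NonZero K}} → HasOrder ψ K → ψ ^ e ≡ 1# → K ∣ e
  order-∣ {ψ} {K} {e} (ψ^K≡1 , minimal) ψ^e≡1 = m%n≡0⇒n∣m e K (ℕ.n≤0⇒n≡0 (ℕ.≮⇒≥ e%K≮0))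
    where
    e%K≮0 : ¬ 0 < e % K
    e%K≮0 0<e%K = minimal (e % K) 0<e%K (m%n<n e K) (trans (sym (^-mod K ψ^K≡1 e)) ψ^e≡1)

  order-^ : ∀ {ζ k m} → HasOrder ζ (k *ℕ m) → 0 < m → HasOrder (ζ ^ m) k
  order-^ {ζ} {k} {m} (ζ^km≡1 , minimal) 0<m =
    trans (sym (^-* ζ m k)) (trans (cong (ζ ^_) (ℕ.*-comm m k)) ζ^km≡1) ,
    λ d 0<d d<k ζ^md≡1 → minimal (m *ℕ d) (ℕ.*-mono-≤ 0<m 0<d)
      (subst (m *ℕ d <_) (ℕ.*-comm m k) (ℕ.*-monoʳ-< m {{>-nonZero 0<m}} d<k)) (trans (^-* ζ m d) ζ^md≡1)

  odd-order⇒^≢-1 : ∀ {ψ K} → ψ ^ K ≡ 1# → ¬ 2 ∣ K → - 1# ≢ 1# → ∀ c → ψ ^ c ≢ - 1#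
  odd-order⇒^≢-1 {ψ} {K} ψ^K≡1 2∤K -1≢1 c ψ^c≡-1 = -1≢1 (begin
    - 1#            ≡⟨ -1^-odd K 2∤K ⟨
    (- 1#) ^ K      ≡⟨ cong (_^ K) ψ^c≡-1 ⟨
    (ψ ^ c) ^ K     ≡⟨ ^-comm ψ c K ⟩
    (ψ ^ K) ^ c     ≡⟨ cong (_^ c) ψ^K≡1 ⟩
    1# ^ c          ≡⟨ 1^ c ⟩
    1#              ∎)

  half-order⇒^≡-1 : ∀ {ψ h} → HasOrder ψ (h *ℕ 2) → 0 < h → ψ ^ h ≡ - 1#
  half-order⇒^≡-1 {ψ} {h} (ψ^2h≡1 , minimal) 0<h with x*x≡1⇒x≡±1 (ψ ^ h) ψ^h*ψ^h≡1
    where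
    ψ^h*ψ^h≡1 : ψ ^ h * ψ ^ h ≡ 1#
    ψ^h*ψ^h≡1 = trans (sym (^-+ ψ h h))
      (trans (cong (ψ ^_) (trans (cong (h +ℕ_) (sym (ℕ.+-identityʳ h))) (ℕ.*-comm 2 h))) ψ^2h≡1)
  ... | inj₁ ψ^h≡1  = ⊥-elim (minimal h 0<h (ℕ.m<m*n h 2 {{>-nonZero 0<h}} (s≤s (s≤s z≤n))) ψ^h≡1)
  ... | inj₂ ψ^h≡-1 = ψ^h≡-1

module Generator (F : FiniteField) (ζ : FiniteField.Carrier F) (gen : FiniteField.IsGenerator F ζ)
                 {n} (size≡1+n : FiniteField.size F ≡ suc n) (2≤n : 2 ≤ n) where

  open import Data.Nat using () renaming (_+_ to _+ℕ_; _*_ to _*ℕ_; _∸_ to _∸ℕ_)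
  import Data.Nat.Properties as ℕ
  open import Data.Nat.DivMod using (_%_; m%n<n)
  open import Data.Nat.Divisibility using (_∣_; divides)
  open import Data.Nat.Coprimality using (Coprime; coprime-divisor)
  open import Data.Nat.Primality using (prime⇒irreducible; prime[2])
  open import Algebra.Structures using (IsCommutativeRing)
  open FiniteField F
  open FieldLemmas F
  open Powers F
  open IsCommutativeRing isCommutativeRing using (zeroˡ; *-identityʳ)
  open Parity using (half-bounds; ∣∧<⇒≡0)

  instance
    n≢0 : NonZero n
    n≢0 = >-nonZero (ℕ.≤-trans (s≤s z≤n) 2≤n)

  count-nonzero≡n : ∑[ x ∈ elements ] χ (nonzero? x) ≡ n
  count-nonzero≡n = ℕ.suc-injective (trans (trans (ℕ.+-comm 1 _) count-nonzero) size≡1+n)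

  ∑-χ-powers : ∀ e → ∑[ x ∈ elements ] ∑[ j < e ] χ (x ≟ (ζ ^ j)) ≡ e
  ∑-χ-powers e = begin
    ∑[ x ∈ elements ] ∑[ j < e ] χ (x ≟ (ζ ^ j))  ≡⟨ ∑∈-∑<-comm elements e _ ⟩
    ∑[ j < e ] ∑[ x ∈ elements ] χ (x ≟ (ζ ^ j))  ≡⟨ ∑<-cong e (λ j _ → ∑-χ-≟ (ζ ^ j)) ⟩
    ∑[ j < e ] 1                                  ≡⟨ ∑<-const e 1 ⟩
    e *ℕ 1                                        ≡⟨ ℕ.*-identityʳ e ⟩
    e                                             ∎
    where open ≡-Reasoning

  ζ^e≡1⇒n≤e : ∀ e .{{_ : NonZero e}} → ζ ^ e ≡ 1# → n ≤ e
  ζ^e≡1⇒n≤e e ζ^e≡1 = begin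
    n                                             ≡⟨ count-nonzero≡n ⟨
    ∑[ x ∈ elements ] χ (nonzero? x)              ≤⟨ ∑∈-mono elements covered ⟩
    ∑[ x ∈ elements ] ∑[ j < e ] χ (x ≟ (ζ ^ j))  ≡⟨ ∑-χ-powers e ⟩
    e                                             ∎
    where
    open ℕ.≤-Reasoning
    covered : ∀ x → χ (nonzero? x) ≤ ∑[ j < e ] χ (x ≟ (ζ ^ j))
    covered x with x ≟ 0#
    ... | yes _   = z≤n
    ... | no x≢0 with gen x x≢0
    ... | i , ζ^i≡x = ℕ.≤-trans (ℕ.≤-reflexive (sym (χ-yes (trans (sym ζ^i≡x) (^-mod e ζ^e≡1 i)) (x ≟ (ζ ^ (i % e))))))
                                (∑<-term e (λ j → χ (x ≟ (ζ ^ j))) (i % e) (m%n<n i e))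

  ζ≢0 : ζ ≢ 0#
  ζ≢0 ζ≡0 = ℕ.<⇒≱ 2≤n (begin
    n                                   ≡⟨ count-nonzero≡n ⟨
    ∑[ x ∈ elements ] χ (nonzero? x)    ≤⟨ ∑∈-mono elements only-one ⟩
    ∑[ x ∈ elements ] χ (x ≟ 1#)        ≡⟨ ∑-χ-≟ 1# ⟩
    1                                   ∎)
    where
    open ℕ.≤-Reasoning
    only-one : ∀ x → χ (nonzero? x) ≤ χ (x ≟ 1#)
    only-one x with x ≟ 0#
    ... | yes _ = z≤n
    ... | no x≢0 with gen x x≢0
    ... | zero  , 1≡x   = ℕ.≤-reflexive (sym (χ-yes (sym 1≡x) (x ≟ 1#)))
    ... | suc i , ζ^i≡x = ⊥-elim (x≢0 (trans (sym ζ^i≡x) (trans (cong (_* ζ ^ i) ζ≡0) (zeroˡ _))))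

  -- Otherwise ζ^0, …, ζ^n would be n + 1 distinct nonzero elements.
  ζ^n≡1 : ζ ^ n ≡ 1#
  ζ^n≡1 with (ζ ^ n) ≟ 1#
  ... | yes ζ^n≡1 = ζ^n≡1
  ... | no  ζ^n≢1 = ⊥-elim (ℕ.<⇒≱ (ℕ.n<1+n n) (begin
    suc n                                             ≡⟨ ∑-χ-powers (suc n) ⟨
    ∑[ x ∈ elements ] ∑[ j < suc n ] χ (x ≟ (ζ ^ j))  ≤⟨ ∑∈-mono elements at-most-once ⟩
    ∑[ x ∈ elements ] χ (nonzero? x)                  ≡⟨ count-nonzero≡n ⟩
    n                                                 ∎))
    where
    open ℕ.≤-Reasoning
    no-small-order : ∀ d → 0 < d → d < suc n → ζ ^ d ≢ 1#
    no-small-order d 0<d d<1+n ζ^d≡1 = ζ^n≢1 (subst (λ e → ζ ^ e ≡ 1#)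
      (ℕ.≤-antisym (ℕ.≤-pred d<1+n) (ζ^e≡1⇒n≤e d {{>-nonZero 0<d}} ζ^d≡1)) ζ^d≡1)
    at-most-once : ∀ x → ∑[ j < suc n ] χ (x ≟ (ζ ^ j)) ≤ χ (nonzero? x)
    at-most-once x with x ≟ 0#
    ... | yes x≡0 = ℕ.≤-reflexive (∑<-χ-none (suc n) (λ j → x ≟ (ζ ^ j))
                      (λ j _ x≡ζ^j → ^-nonzero j ζ≢0 (trans (sym x≡ζ^j) x≡0)))
    ... | no _    = ∑<-χ-≤1 (suc n) (λ j → x ≟ (ζ ^ j)) (λ i j i<1+n j<1+n x≡ζ^i x≡ζ^j →
                      ^-injective (suc n) ζ≢0 no-small-order i<1+n j<1+n (trans (sym x≡ζ^i) x≡ζ^j))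

  generator-order : HasOrder ζ n
  generator-order = ζ^n≡1 , λ d 0<d d<n ζ^d≡1 → ℕ.<⇒≱ d<n (ζ^e≡1⇒n≤e d {{>-nonZero 0<d}} ζ^d≡1)

  discrete-log : ∀ x → x ≢ 0# → ∃[ i ] i < n × ζ ^ i ≡ x
  discrete-log x x≢0 with gen x x≢0
  ... | i , ζ^i≡x = i % n , m%n<n i n , trans (sym (^-mod n ζ^n≡1 i)) ζ^i≡x

  ∑-generator : ∀ (h : Carrier → ℕ) → ∑[ x ∈ elements ] h x ≡ h 0# +ℕ ∑[ i < n ] h (ζ ^ i)
  ∑-generator h = begin
    ∑[ x ∈ elements ] h x
      ≡⟨ ∑∈-cong elements split ⟩
    ∑[ x ∈ elements ] (χ (x ≟ 0#) *ℕ h 0# +ℕ ∑[ i < n ] (χ (x ≟ (ζ ^ i)) *ℕ h (ζ ^ i)))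
      ≡⟨ ∑∈-distrib-+ elements _ _ ⟩
    ∑[ x ∈ elements ] (χ (x ≟ 0#) *ℕ h 0#) +ℕ ∑[ x ∈ elements ] ∑[ i < n ] (χ (x ≟ (ζ ^ i)) *ℕ h (ζ ^ i))
      ≡⟨ cong₂ _+ℕ_ (∑-select 0# (λ _ → h 0#)) (∑∈-∑<-comm elements n _) ⟩
    h 0# +ℕ ∑[ i < n ] ∑[ x ∈ elements ] (χ (x ≟ (ζ ^ i)) *ℕ h (ζ ^ i))
      ≡⟨ cong (h 0# +ℕ_) (∑<-cong n (λ i _ → ∑-select (ζ ^ i) (λ _ → h (ζ ^ i)))) ⟩
    h 0# +ℕ ∑[ i < n ] h (ζ ^ i)
      ∎
    where
    open ≡-Reasoning
    split : ∀ x → h x ≡ χ (x ≟ 0#) *ℕ h 0# +ℕ ∑[ i < n ] (χ (x ≟ (ζ ^ i)) *ℕ h (ζ ^ i))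
    split x with x ≟ 0#
    ... | yes refl = sym (trans (cong₂ _+ℕ_ (ℕ.+-identityʳ (h 0#)) (∑<-zero n (λ i _ →
                       cong (_*ℕ h (ζ ^ i)) (χ-no (λ 0≡ζ^i → ^-nonzero i ζ≢0 (sym 0≡ζ^i)) (0# ≟ (ζ ^ i))))))
                       (ℕ.+-identityʳ (h 0#)))
    ... | no x≢0 with discrete-log x x≢0
    ... | i₀ , i₀<n , refl = sym (∑<-select n (λ i → (ζ ^ i₀) ≟ (ζ ^ i)) (λ i → h (ζ ^ i)) i₀ i₀<n refl
                               (λ i i<n ζ^i₀≡ζ^i → order-injective generator-order i<n i₀<n (sym ζ^i₀≡ζ^i)))

  2∣n⇒-1≢1 : 2 ∣ n → - 1# ≢ 1#
  2∣n⇒-1≢1 (divides h n≡h*2) -1≡1 with half-bounds (ℕ.≤-trans (s≤s z≤n) 2≤n) n≡h*2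
  ... | 0<h , h<n = proj₂ generator-order h 0<h h<n
                      (trans (half-order⇒^≡-1 (subst (HasOrder ζ) n≡h*2 generator-order) 0<h) -1≡1)

  2∤n⇒-1≡1 : ¬ 2 ∣ n → - 1# ≡ 1#
  2∤n⇒-1≡1 2∤n with (- 1#) ≟ 1#
  ... | yes -1≡1 = -1≡1
  ... | no  -1≢1 with discrete-log (- 1#) -1≢0
  ... | i , i<n , ζ^i≡-1 = ⊥-elim (-1≢1 (trans (sym ζ^i≡-1) (cong (ζ ^_) (∣∧<⇒≡0 n∣i i<n))))
    where
    ζ^2i≡1 : ζ ^ (2 *ℕ i) ≡ 1#
    ζ^2i≡1 = begin
      ζ ^ (2 *ℕ i)            ≡⟨ ^-* ζ 2 i ⟩
      (ζ ^ 2) ^ i             ≡⟨ ^-comm ζ 2 i ⟩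
      ζ ^ i * (ζ ^ i * 1#)    ≡⟨ cong (λ y → y * (y * 1#)) ζ^i≡-1 ⟩
      - 1# * (- 1# * 1#)      ≡⟨ cong (- 1# *_) (*-identityʳ (- 1#)) ⟩
      - 1# * - 1#             ≡⟨ -1*-1≡1 ⟩
      1#                      ∎
      where open ≡-Reasoning
    coprime : Coprime n 2
    coprime (d∣n , d∣2) with prime⇒irreducible prime[2] d∣2
    ... | inj₁ d≡1 = d≡1
    ... | inj₂ refl = ⊥-elim (2∤n d∣n)
    n∣i : n ∣ i
    n∣i = coprime-divisor coprime (order-∣ generator-order ζ^2i≡1)

module FermatCount (F : FiniteField) (ζ : FiniteField.Carrier F) (gen : FiniteField.IsGenerator F ζ)
                   (k m : ℕ) (size≡1+km : FiniteField.size F ≡ suc (k Data.Nat.* m))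
                   (3≤k : 3 ≤ k) (0<m : 0 < m) where

  open import Data.Nat using () renaming (_+_ to _+ℕ_; _*_ to _*ℕ_; _∸_ to _∸ℕ_; _^_ to _^ℕ_)
  import Data.Nat.Properties as ℕ
  open import Data.Nat.Divisibility using (_∣_; divides)
  open import Data.Nat.Solver using (module +-*-Solver)
  open import Data.List using (List; upTo; map; cartesianProduct)
  open import Data.List.Properties using (map-upTo)
  open import Data.List.Relation.Unary.Any using (any?)
  open import Relation.Nullary.Decidable using (_×-dec_)
  open import Algebra.Structures using (IsCommutativeRing)
  open import Algebra.Bundles using (CommutativeRing)
  open FiniteField F
  open FieldLemmas F
  open import Algebra.Properties.Ring (CommutativeRing.ring commutativeRing) using (+-cancelʳ)
  open Powers F
  open Parity using (half-bounds)
  open IsCommutativeRing isCommutativeRing using (+-identityˡ; +-identityʳ; *-identityʳ; distribˡ)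

  0<k : 0 < k
  0<k = ℕ.≤-trans (s≤s z≤n) 3≤k

  open Generator F ζ gen size≡1+km (ℕ.≤-trans (s≤s (s≤s z≤n)) (ℕ.*-mono-≤ 3≤k 0<m))

  φ : Carrier
  φ = ζ ^ m

  Φ : List Carrier
  Φ = cyclic φ k

  φ-order : HasOrder φ k
  φ-order = order-^ generator-order 0<m

  φ-injective : ∀ {i j} → i < k → j < k → φ ^ i ≡ φ ^ j → i ≡ j
  φ-injective = order-injective φ-order

  ∑Φ : (Carrier → ℕ) → ℕ
  ∑Φ g = ∑[ j < k ] g (φ ^ j)

  syntax ∑Φ (λ x → e) = ∑[ x ∈Φ ] e

  φ-periodic : ∀ (g : Carrier → ℕ) → Periodic k (λ j → g (φ ^ j))
  φ-periodic g i = cong g (^-periodic {K = k} (proj₁ φ-order) i)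

  ∑Φ-linear : ∀ (f g : Carrier → ℕ) → ∑[ x ∈Φ ] (f x +ℕ m *ℕ g x) ≡ ∑Φ f +ℕ m *ℕ ∑Φ g
  ∑Φ-linear f g = trans (∑<-distrib-+ k _ _) (cong (∑Φ f +ℕ_) (∑<-distribˡ-* k m _))

  powerSum : (Carrier → ℕ) → ℕ
  powerSum g = g 0# +ℕ m *ℕ ∑Φ g

  ∑-^m : ∀ (g : Carrier → ℕ) → ∑[ x ∈ elements ] g (x ^ m) ≡ powerSum g
  ∑-^m g = begin
    ∑[ x ∈ elements ] g (x ^ m)                    ≡⟨ ∑-generator (λ x → g (x ^ m)) ⟩
    g (0# ^ m) +ℕ ∑[ i < k *ℕ m ] g ((ζ ^ i) ^ m)  ≡⟨ cong₂ _+ℕ_ (cong g (0^ 0<m))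
                                                              (∑<-cong (k *ℕ m) (λ i _ → cong g (^-comm ζ i m))) ⟩
    g 0# +ℕ ∑[ i < k *ℕ m ] g (φ ^ i)              ≡⟨ cong (g 0# +ℕ_) (∑<-periodic k m _ (φ-periodic g)) ⟩
    powerSum g                                     ∎
    where open ≡-Reasoning

  χ-∈Φ : ∀ x (G : Carrier → Carrier) → (∀ {a b} → G a ≡ G b → a ≡ b) →
         χ (any? (λ y → x ≟ G y) Φ) ≡ ∑[ y ∈Φ ] χ (x ≟ G y)
  χ-∈Φ x G G-injective = trans (cong (λ ys → χ (any? (λ y → x ≟ G y) ys)) (map-upTo (φ ^_) k))
    (χ-any-applyUpTo (λ y → x ≟ G y) (φ ^_) k (λ i j i<k j<k x≡Gφ^i x≡Gφ^j →
      φ-injective i<k j<k (G-injective (trans (sym x≡Gφ^i) x≡Gφ^j))))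

  count-∩ : ∀ (G H : Carrier → Carrier) → (∀ {a b} → G a ≡ G b → a ≡ b) → (∀ {a b} → H a ≡ H b → a ≡ b) →
            count (λ x → any? (λ y → x ≟ G y) Φ ×-dec any? (λ y → x ≟ H y) Φ)
              ≡ ∑[ a ∈Φ ] ∑[ c ∈Φ ] χ (G a ≟ H c)
  count-∩ G H G-injective H-injective = begin
    count (λ x → any? (λ y → x ≟ G y) Φ ×-dec any? (λ y → x ≟ H y) Φ)
      ≡⟨ length-filter _ elements ⟩
    ∑[ x ∈ elements ] χ (any? (λ y → x ≟ G y) Φ ×-dec any? (λ y → x ≟ H y) Φ)
      ≡⟨ ∑∈-cong elements (λ x → trans (χ-×-dec (any? (λ y → x ≟ G y) Φ) (any? (λ y → x ≟ H y) Φ))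
                                       (cong₂ _*ℕ_ (χ-∈Φ x G G-injective) (χ-∈Φ x H H-injective))) ⟩
    ∑[ x ∈ elements ] (∑[ a ∈Φ ] χ (x ≟ G a) *ℕ ∑[ c ∈Φ ] χ (x ≟ H c))
      ≡⟨ ∑∈-cong elements (λ x → sym (∑<-distribʳ-* k _ _)) ⟩
    ∑[ x ∈ elements ] ∑[ a ∈Φ ] (χ (x ≟ G a) *ℕ ∑[ c ∈Φ ] χ (x ≟ H c))
      ≡⟨ ∑∈-∑<-comm elements k _ ⟩
    ∑[ a ∈Φ ] ∑[ x ∈ elements ] (χ (x ≟ G a) *ℕ ∑[ c ∈Φ ] χ (x ≟ H c))
      ≡⟨ ∑<-cong k (λ a _ → ∑-select (G (φ ^ a)) _) ⟩
    ∑[ a ∈Φ ] ∑[ c ∈Φ ] χ (G a ≟ H c)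
      ∎
    where open ≡-Reasoning

  t : ℕ
  t = ∑[ a ∈Φ ] ∑[ c ∈Φ ] χ (a ≟ (c + 1#))

  tValue≡t : tValue F φ k ≡ t
  tValue≡t = count-∩ (λ y → y) (_+ 1#) (λ a≡b → a≡b) (+-cancelʳ 1# _ _)

  s : ℕ
  s = ∑[ j < k ∸ℕ 1 ] ∑[ a ∈Φ ] ∑[ c ∈Φ ] χ ((a + 1#) ≟ (c + φ ^ suc j))

  sValue≡s : sValue F φ k ≡ s
  sValue≡s = begin
    sValue F φ k                              ≡⟨ sum-map (map suc (upTo (k ∸ℕ 1))) term ⟩
    ∑[ j ∈ map suc (upTo (k ∸ℕ 1)) ] term j   ≡⟨ ∑∈-map suc (upTo (k ∸ℕ 1)) term ⟩
    ∑[ j ∈ upTo (k ∸ℕ 1) ] term (suc j)       ≡⟨ ∑∈-applyUpTo (λ j → j) (k ∸ℕ 1) (term ∘ suc) ⟩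
    ∑[ j < k ∸ℕ 1 ] term (suc j)              ≡⟨ ∑<-cong (k ∸ℕ 1) (λ j _ → count-∩ (_+ 1#) (_+ φ ^ suc j)
                                                   (+-cancelʳ 1# _ _) (+-cancelʳ (φ ^ suc j) _ _)) ⟩
    s                                         ∎
    where
    open ≡-Reasoning
    term : ℕ → ℕ
    term j = count (λ x → inAdd? Φ 1# x ×-dec inAdd? Φ (φ ^ j) x)

  solves : Carrier → Carrier → Carrier → ℕ
  solves u v w = χ ((u + v - w) ≟ 1#)

  solves≡ : ∀ u v w → solves u v w ≡ χ ((u + v) ≟ (w + 1#))
  solves≡ u v w = χ-cong x-y≡1⇔x≡y+1 _ _

  fermatCount≡powerSum³ : fermatCount F m ≡ powerSum (λ u → powerSum (λ v → powerSum (λ w → solves u v w)))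
  fermatCount≡powerSum³ = begin
    fermatCount F m
      ≡⟨ trans (length-filter _ (cartesianProduct elements (cartesianProduct elements elements)))
               (trans (∑∈-cartesianProduct elements _ _)
                      (∑∈-cong elements (λ x → ∑∈-cartesianProduct elements elements _))) ⟩
    ∑[ x ∈ elements ] ∑[ y ∈ elements ] ∑[ z ∈ elements ] solves (x ^ m) (y ^ m) (z ^ m)
      ≡⟨ ∑∈-cong elements (λ x → ∑∈-cong elements (λ y → ∑-^m (solves (x ^ m) (y ^ m)))) ⟩
    ∑[ x ∈ elements ] ∑[ y ∈ elements ] powerSum (solves (x ^ m) (y ^ m))
      ≡⟨ ∑∈-cong elements (λ x → ∑-^m (λ v → powerSum (solves (x ^ m) v))) ⟩
    ∑[ x ∈ elements ] powerSum (λ v → powerSum (solves (x ^ m) v))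
      ≡⟨ ∑-^m (λ u → powerSum (λ v → powerSum (solves u v))) ⟩
    powerSum (λ u → powerSum (λ v → powerSum (λ w → solves u v w)))
      ∎
    where open ≡-Reasoning

  ∑Φ-powerSum : ∀ (g : Carrier → Carrier → ℕ) →
                ∑[ a ∈Φ ] powerSum (g a) ≡ ∑[ a ∈Φ ] g a 0# +ℕ m *ℕ ∑[ a ∈Φ ] ∑[ b ∈Φ ] g a b
  ∑Φ-powerSum g = ∑Φ-linear (λ a → g a 0#) (λ a → ∑Φ (g a))

  powerSum³-expand : ∀ (A : Carrier → Carrier → Carrier → ℕ) →
    powerSum (λ u → powerSum (λ v → powerSum (λ w → A u v w)))
      ≡ (A 0# 0# 0# +ℕ m *ℕ ∑[ c ∈Φ ] A 0# 0# c)
        +ℕ m *ℕ (∑[ b ∈Φ ] A 0# b 0# +ℕ m *ℕ ∑[ b ∈Φ ] ∑[ c ∈Φ ] A 0# b c)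
        +ℕ m *ℕ ((∑[ a ∈Φ ] A a 0# 0# +ℕ m *ℕ ∑[ a ∈Φ ] ∑[ c ∈Φ ] A a 0# c)
                 +ℕ m *ℕ (∑[ a ∈Φ ] ∑[ b ∈Φ ] A a b 0# +ℕ m *ℕ ∑[ a ∈Φ ] ∑[ b ∈Φ ] ∑[ c ∈Φ ] A a b c))
  powerSum³-expand A = cong₂ _+ℕ_
    (cong (λ z → A 0# 0# 0# +ℕ m *ℕ ∑[ c ∈Φ ] A 0# 0# c +ℕ m *ℕ z) (∑Φ-powerSum (A 0#)))
    (cong (m *ℕ_) (begin
      ∑[ a ∈Φ ] powerSum (λ v → powerSum (A a v))
        ≡⟨ ∑Φ-powerSum (λ a v → powerSum (A a v)) ⟩
      ∑[ a ∈Φ ] powerSum (A a 0#) +ℕ m *ℕ ∑[ a ∈Φ ] ∑[ b ∈Φ ] powerSum (A a b)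
        ≡⟨ cong₂ _+ℕ_ (∑Φ-powerSum (λ a → A a 0#))
                      (cong (m *ℕ_) (trans (∑<-cong k (λ a _ → ∑Φ-powerSum (A (φ ^ a))))
                        (∑Φ-linear (λ a → ∑[ b ∈Φ ] A a b 0#) (λ a → ∑[ b ∈Φ ] ∑[ c ∈Φ ] A a b c)))) ⟩
      (∑[ a ∈Φ ] A a 0# 0# +ℕ m *ℕ ∑[ a ∈Φ ] ∑[ c ∈Φ ] A a 0# c)
        +ℕ m *ℕ (∑[ a ∈Φ ] ∑[ b ∈Φ ] A a b 0# +ℕ m *ℕ ∑[ a ∈Φ ] ∑[ b ∈Φ ] ∑[ c ∈Φ ] A a b c)
        ∎))
    where open ≡-Reasoning

  e : ℕ
  e = ∑[ c ∈Φ ] χ (c ≟ (- 1#))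

  solves-000 : solves 0# 0# 0# ≡ 0
  solves-000 = trans (solves≡ 0# 0# 0#) (χ-no 0+0≢0+1 _)
    where
    0+0≢0+1 : 0# + 0# ≢ 0# + 1#
    0+0≢0+1 eq = 0≢1 (trans (sym (+-identityˡ 0#)) (trans eq (+-identityˡ 1#)))

  solves-00c : ∑[ c ∈Φ ] solves 0# 0# c ≡ e
  solves-00c = ∑<-cong k (λ c _ →
    trans (solves≡ 0# 0# (φ ^ c)) (trans (χ-≟-cong (+-identityˡ 0#) refl) (χ-cong 0≡x+1⇔x≡-1 _ _)))

  1∈Φ-once : ∑[ b ∈Φ ] χ (b ≟ 1#) ≡ 1
  1∈Φ-once = ∑<-χ-unique k (λ b → (φ ^ b) ≟ 1#) 0 0<k refl (λ b b<k φ^b≡1 → φ-injective b<k 0<k φ^b≡1)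

  solves-0b0 : ∑[ b ∈Φ ] solves 0# b 0# ≡ 1
  solves-0b0 = trans (∑<-cong k (λ b _ →
    trans (solves≡ 0# (φ ^ b) 0#) (χ-≟-cong (+-identityˡ (φ ^ b)) (+-identityˡ 1#)))) 1∈Φ-once

  solves-a00 : ∑[ a ∈Φ ] solves a 0# 0# ≡ 1
  solves-a00 = trans (∑<-cong k (λ a _ →
    trans (solves≡ (φ ^ a) 0# 0#) (χ-≟-cong (+-identityʳ (φ ^ a)) (+-identityˡ 1#)))) 1∈Φ-once

  solves-0bc : ∑[ b ∈Φ ] ∑[ c ∈Φ ] solves 0# b c ≡ t
  solves-0bc = ∑<-cong k (λ b _ → ∑<-cong k (λ c _ →
    trans (solves≡ 0# (φ ^ b) (φ ^ c)) (χ-≟-cong (+-identityˡ (φ ^ b)) refl)))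

  solves-a0c : ∑[ a ∈Φ ] ∑[ c ∈Φ ] solves a 0# c ≡ t
  solves-a0c = ∑<-cong k (λ a _ → ∑<-cong k (λ c _ →
    trans (solves≡ (φ ^ a) 0# (φ ^ c)) (χ-≟-cong (+-identityʳ (φ ^ a)) refl)))

  ∑-scaled-by-φ^b : ∀ b → b < k → ∑[ a ∈Φ ] χ ((a + φ ^ b) ≟ 1#) ≡ ∑[ c ∈Φ ] χ ((c + 1#) ≟ (φ ^ (k ∸ℕ b)))
  ∑-scaled-by-φ^b b b<k = begin
    ∑[ a < k ] χ ((φ ^ a + φ ^ b) ≟ 1#)
      ≡⟨ ∑<-rotate k b _ (φ-periodic (λ y → χ ((y + φ ^ b) ≟ 1#))) ⟨
    ∑[ a < k ] χ ((φ ^ (b +ℕ a) + φ ^ b) ≟ 1#)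
      ≡⟨ ∑<-cong k (λ a _ → χ-cong (divide-by-φ^b a) _ _) ⟩
    ∑[ c < k ] χ ((φ ^ c + 1#) ≟ (φ ^ (k ∸ℕ b)))
      ∎
    where
    open ≡-Reasoning
    φ^b*φ^[k-b]≡1 : φ ^ b * φ ^ (k ∸ℕ b) ≡ 1#
    φ^b*φ^[k-b]≡1 = trans (sym (^-+ φ b (k ∸ℕ b))) (trans (cong (φ ^_) (ℕ.m+[n∸m]≡n (ℕ.<⇒≤ b<k))) (proj₁ φ-order))
    factor : ∀ a → φ ^ (b +ℕ a) + φ ^ b ≡ φ ^ b * (φ ^ a + 1#)
    factor a = trans (cong₂ _+_ (^-+ φ b a) (sym (*-identityʳ (φ ^ b)))) (sym (distribˡ (φ ^ b) (φ ^ a) 1#))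
    divide-by-φ^b : ∀ a → φ ^ (b +ℕ a) + φ ^ b ≡ 1# ⇔ φ ^ a + 1# ≡ φ ^ (k ∸ℕ b)
    divide-by-φ^b a = mk⇔
      (λ eq → *-cancelˡ (φ ^ b) (^-nonzero b (^-nonzero m ζ≢0)) (trans (sym (factor a)) (trans eq (sym φ^b*φ^[k-b]≡1))))
      (λ eq → trans (factor a) (trans (cong (φ ^ b *_) eq) φ^b*φ^[k-b]≡1))

  -- The substitution a ↦ a + b and division by φ^b turn φ^a + φ^b = 1 into φ^a + 1 = φ^(k − b);
  -- reflecting b ↦ k − b then gives t.
  solves-ab0 : ∑[ a ∈Φ ] ∑[ b ∈Φ ] solves a b 0# ≡ t
  solves-ab0 = begin
    ∑[ a ∈Φ ] ∑[ b ∈Φ ] solves a b 0#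
      ≡⟨ ∑<-cong k (λ a _ → ∑<-cong k (λ b _ → trans (solves≡ (φ ^ a) (φ ^ b) 0#) (χ-≟-cong refl (+-identityˡ 1#)))) ⟩
    ∑[ a < k ] ∑[ b < k ] χ ((φ ^ a + φ ^ b) ≟ 1#)
      ≡⟨ ∑<-comm k k _ ⟩
    ∑[ b < k ] ∑[ a < k ] χ ((φ ^ a + φ ^ b) ≟ 1#)
      ≡⟨ ∑<-cong k ∑-scaled-by-φ^b ⟩
    ∑[ b < k ] S (k ∸ℕ b)
      ≡⟨ ∑<-reflect k S (λ i → ∑<-cong k (λ c _ → χ-≟-cong refl (^-periodic {K = k} (proj₁ φ-order) i))) ⟩
    ∑[ b < k ] S b
      ≡⟨ ∑<-cong k (λ b _ → ∑<-cong k (λ c _ → χ-cong (mk⇔ sym sym) _ _)) ⟩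
    t ∎
    where
    open ≡-Reasoning
    S : ℕ → ℕ
    S d = ∑[ c ∈Φ ] χ ((c + 1#) ≟ (φ ^ d))

  solves-abc : ∑[ a ∈Φ ] ∑[ b ∈Φ ] ∑[ c ∈Φ ] solves a b c ≡ k +ℕ s
  solves-abc = begin
    ∑[ a ∈Φ ] ∑[ b ∈Φ ] ∑[ c ∈Φ ] solves a b c
      ≡⟨ ∑<-cong k (λ a _ → ∑<-cong k (λ b _ → ∑<-cong k (λ c _ → solves≡ (φ ^ a) (φ ^ b) (φ ^ c)))) ⟩
    ∑[ a < k ] ∑[ b < k ] ∑[ c < k ] χ ((φ ^ a + φ ^ b) ≟ (φ ^ c + 1#))
      ≡⟨ ∑<-comm k k _ ⟩
    ∑[ b < k ] ∑[ a < k ] ∑[ c < k ] χ ((φ ^ a + φ ^ b) ≟ (φ ^ c + 1#))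
      ≡⟨ ∑<-front _ 0<k ⟩
    ∑[ a < k ] ∑[ c < k ] χ ((φ ^ a + 1#) ≟ (φ ^ c + 1#))
      +ℕ ∑[ j < k ∸ℕ 1 ] ∑[ a < k ] ∑[ c < k ] χ ((φ ^ a + φ ^ suc j) ≟ (φ ^ c + 1#))
      ≡⟨ cong₂ _+ℕ_ diagonal (∑<-cong (k ∸ℕ 1) (λ j _ → trans (∑<-comm k k _)
           (∑<-cong k (λ c _ → ∑<-cong k (λ a _ → χ-cong (mk⇔ sym sym) _ _))))) ⟩
    k +ℕ s ∎
    where
    open ≡-Reasoning
    diagonal : ∑[ a < k ] ∑[ c < k ] χ ((φ ^ a + 1#) ≟ (φ ^ c + 1#)) ≡ k
    diagonal = begin
      ∑[ a < k ] ∑[ c < k ] χ ((φ ^ a + 1#) ≟ (φ ^ c + 1#))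
        ≡⟨ ∑<-cong k (λ a a<k → ∑<-χ-unique k (λ c → (φ ^ a + 1#) ≟ (φ ^ c + 1#)) a a<k refl
             (λ c c<k eq → φ-injective c<k a<k (sym (+-cancelʳ 1# _ _ eq)))) ⟩
      ∑[ _ < k ] 1  ≡⟨ ∑<-const k 1 ⟩
      k *ℕ 1        ≡⟨ ℕ.*-identityʳ k ⟩
      k             ∎

  collect-terms : ∀ m e t x → (0 +ℕ m *ℕ e) +ℕ m *ℕ (1 +ℕ m *ℕ t) +ℕ m *ℕ ((1 +ℕ m *ℕ t) +ℕ m *ℕ (t +ℕ m *ℕ x))
                              ≡ m ^ℕ 3 *ℕ x +ℕ 3 *ℕ m ^ℕ 2 *ℕ t +ℕ (2 +ℕ e) *ℕ m
  collect-terms = solve 4 (λ m e t x →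
      (con 0 :+ m :* e) :+ m :* (con 1 :+ m :* t) :+ m :* ((con 1 :+ m :* t) :+ m :* (t :+ m :* x))
      := m :^ 3 :* x :+ con 3 :* m :^ 2 :* t :+ (con 2 :+ e) :* m) refl
    where open +-*-Solver

  fermatCount≡formula : ∀ {e′} → e ≡ e′ →
    fermatCount F m ≡ m ^ℕ 3 *ℕ (k +ℕ sValue F φ k) +ℕ 3 *ℕ m ^ℕ 2 *ℕ tValue F φ k +ℕ (2 +ℕ e′) *ℕ m
  fermatCount≡formula refl = begin
    fermatCount F m
      ≡⟨ fermatCount≡powerSum³ ⟩
    powerSum (λ u → powerSum (λ v → powerSum (λ w → solves u v w)))
      ≡⟨ powerSum³-expand solves ⟩
    _ ≡⟨ cong₂ _+ℕ_ (cong₂ _+ℕ_ (cong₂ _+ℕ_ solves-000 (cong (m *ℕ_) solves-00c))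
                                (cong (m *ℕ_) (cong₂ _+ℕ_ solves-0b0 (cong (m *ℕ_) solves-0bc))))
                     (cong (m *ℕ_) (cong₂ _+ℕ_ (cong₂ _+ℕ_ solves-a00 (cong (m *ℕ_) solves-a0c))
                                                (cong (m *ℕ_) (cong₂ _+ℕ_ solves-ab0 (cong (m *ℕ_) solves-abc))))) ⟩
    (0 +ℕ m *ℕ e) +ℕ m *ℕ (1 +ℕ m *ℕ t) +ℕ m *ℕ ((1 +ℕ m *ℕ t) +ℕ m *ℕ (t +ℕ m *ℕ (k +ℕ s)))
      ≡⟨ collect-terms m e t (k +ℕ s) ⟩
    m ^ℕ 3 *ℕ (k +ℕ s) +ℕ 3 *ℕ m ^ℕ 2 *ℕ t +ℕ (2 +ℕ e) *ℕ m
      ≡⟨ cong₂ (λ s′ t′ → m ^ℕ 3 *ℕ (k +ℕ s′) +ℕ 3 *ℕ m ^ℕ 2 *ℕ t′ +ℕ (2 +ℕ e) *ℕ m) sValue≡s tValue≡t ⟨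
    m ^ℕ 3 *ℕ (k +ℕ sValue F φ k) +ℕ 3 *ℕ m ^ℕ 2 *ℕ tValue F φ k +ℕ (2 +ℕ e) *ℕ m
      ∎
    where open ≡-Reasoning

  e≡1 : ∀ c₀ → c₀ < k → φ ^ c₀ ≡ - 1# → e ≡ 1
  e≡1 c₀ c₀<k φ^c₀≡-1 = ∑<-χ-unique k (λ c → (φ ^ c) ≟ (- 1#)) c₀ c₀<k φ^c₀≡-1
    (λ c c<k φ^c≡-1 → φ-injective c<k c₀<k (trans φ^c≡-1 (sym φ^c₀≡-1)))

  2∤k⇒e≡0 : ¬ 2 ∣ k → 2 ∣ k *ℕ m → e ≡ 0
  2∤k⇒e≡0 2∤k 2∣km = ∑<-χ-none k (λ c → (φ ^ c) ≟ (- 1#))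
    (λ c _ → odd-order⇒^≢-1 (proj₁ φ-order) 2∤k (2∣n⇒-1≢1 2∣km) c)

  2∣k⇒e≡1 : 2 ∣ k → e ≡ 1
  2∣k⇒e≡1 (divides h k≡h*2) with half-bounds 0<k k≡h*2
  ... | 0<h , h<k = e≡1 h h<k (half-order⇒^≡-1 (subst (HasOrder φ) k≡h*2 φ-order) 0<h)

  2∤km⇒e≡1 : ¬ 2 ∣ k *ℕ m → e ≡ 1
  2∤km⇒e≡1 2∤km = e≡1 0 0<k (sym (2∤n⇒-1≡1 2∤km))

open import Defs using (Carrier; CircularPK)
open import Data.Nat using (_+_; _*_; _^_; _∸_)
open import Data.Nat.Divisibility using (_∣_)
open import Data.Nat.Primality using (Prime; prime⇒nonZero)
import Data.Nat.Properties as ℕ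
open Parity using (2∣pred-odd-prime^; 2∤pred-2^)

theorem17 : (p r : ℕ) → Prime p → (F : FiniteField) → FiniteField.size F ≡ p ^ r →
    (k m : ℕ) → 3 ≤ k → (p ^ r) ∸ 1 ≡ k * m →
    (ζ : Carrier F) → FiniteField.IsGenerator F ζ →
    CircularPK p k →
    let φ = FiniteField._^_ F ζ m
        s = sValue F φ k
        t = tValue F φ k
        N = fermatCount F m
    in ((¬ (2 ∣ k) × ¬ (p ≡ 2)) → N ≡ m ^ 3 * (k + s) + 3 * m ^ 2 * t + 2 * m)
     × ((2 ∣ k ⊎ p ≡ 2) → N ≡ m ^ 3 * (k + s) + 3 * m ^ 2 * t + 3 * m)
theorem17 p r p-prime F size≡p^r k m 3≤k p^r-1≡km ζ generator _ =
  (λ (2∤k , p≢2) → fermatCount≡formula (2∤k⇒e≡0 2∤k (2∣pred-odd-prime^ {r = r} p-prime p≢2 (sym 1+km≡p^r)))) ,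
  λ { (inj₁ 2∣k)  → fermatCount≡formula (2∣k⇒e≡1 2∣k)
    ; (inj₂ refl) → fermatCount≡formula (2∤km⇒e≡1 (2∤pred-2^ {r = r} (sym 1+km≡p^r) (ℕ.*-mono-≤ 0<k 0<m))) }
  where
  1+km≡p^r : suc (k * m) ≡ p ^ r
  1+km≡p^r = trans (cong suc (sym p^r-1≡km)) (ℕ.m+[n∸m]≡n (ℕ.m^n>0 p {{prime⇒nonZero p-prime}} r))

  size≡1+km : FiniteField.size F ≡ suc (k * m)
  size≡1+km = trans size≡p^r (sym 1+km≡p^r)

  0<m : 0 < m
  0<m = ℕ.n≢0⇒n>0 λ m≡0 → ℕ.<⇒≱ (FieldLemmas.2≤size F)
    (ℕ.≤-reflexive (trans size≡1+km (cong suc (trans (cong (k *_) m≡0) (ℕ.*-zeroʳ k)))))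

  open FermatCount F ζ generator k m size≡1+km 3≤k 0<m
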